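{- Let $\epsilon>0$ and $c_{\mathsf{loose}}<1/3$. If $(V,E_{\ne},E_{=})$ is a satisfiable $c_{\mathsf{loose}}\epsilon$-loose instance of 3-coloring with equality, then the graph $H$ produced from it by the tensor reduction is $\epsilon$-near $K_3\times G$ for some graph $G$.
   Context: Graphs are finite, undirected, simple, loopless; $\Gamma_X(v)$ is the neighbourhood of $v$ in $X$. The tensor product $F\times G$ has vertex set $V(F)\times V(G)$, with $(f,g)$, $(f',g')$ adjacent iff $\{f,f'\}\in E(F)$ and $\{g,g'\}\in E(G)$; $K_3$ is the complete graph on three vertices. With $P=K_3\times G$, a graph $H$ is $\epsilon$-near $K_3\times G$ if there is $E'\subseteq E(P)$ such that every vertex $w$ of $P$ has at most $\epsilon|\Gamma_P(w)|$ incident edges in $E'$ and $H\cong(V(P),E(P)\setminus E')$. An instance of 3-coloring with equality is a finite set $V$ with two sets $E_{\ne}$ (coloring constraints) and $E_{=}$ (equality constraints) of 2-element subsets of $V$; an assignment $\phi:V\to\{1,2,3\}$ satisfies it if $\phi(u)\ne\phi(v)$ for $\{u,v\}\in E_{\ne}$ and $\phi(u)=\phi(v)$ for $\{u,v\}\in E_{=}$. A vertex is $\delta$-loose if at most a $\delta$ fraction of the constraints containing it are coloring constraints; an instance is $\delta$-loose if all its vertices are. The tensor reduction maps $(V,E_{\ne},E_{=})$ to the graph $H$ with vertex set $V\times[3]^3$ and the following edges, for $x,y\in[3]^3$: for each $v\in V$, $\{(v,x),(v,y)\}$ is an edge iff $x_i\ne y_i$ for all $i\in[3]$; for each $\{u,v\}\in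 E_{=}$, $\{(u,x),(v,y)\}$ is an edge iff $x_i\ne y_i$ for all $i\in[3]$; for each $\{u,v\}\in E_{\ne}$, $\{(u,x),(v,y)\}$ is an edge iff $x_i\ne y_j$ for all $i,j\in[3]$ with $i\ne j$.
   Formalization: The parameters ε and $c_{\mathsf{loose}}$ range over the rationals. -}

module Defs where

open import Data.Bool using (Bool; true; false; _∧_; _∨_; not; if_then_else_)
open import Data.Nat using (ℕ; zero; suc; _+_)
open import Data.Fin using (Fin)
open import Data.Fin.Properties using (_≟_)
open import Data.List using (List; []; _∷_; allFin; cartesianProduct)
open import Data.Product using (_×_; _,_; Σ; ∃; ∃-syntax)
open import Data.Integer using (+_)
open import Data.Rational using (ℚ; _/_; _*_; _≤_)
open import Relation.Nullary using (¬_)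
open import Relation.Nullary.Decidable using (⌊_⌋)
open import Relation.Binary.PropositionalEquality using (_≡_; _≢_)
open import Function.Bundles using (_↔_; Inverse)

count : {A : Set} → List A → (A → Bool) → ℕ
count []       p = 0
count (x ∷ xs) p = if p x then suc (count xs p) else count xs p

ℕ→ℚ : ℕ → ℚ
ℕ→ℚ k = + k / 1

_==_ : {n : ℕ} → Fin n → Fin n → Bool
i == j = ⌊ i ≟ j ⌋

_=/=_ : {n : ℕ} → Fin n → Fin n → Bool
i =/= j = not (i == j)

-- Simple loopless undirected graphs on a vertex type V
-- (finiteness is provided by the concrete vertex types used below,
--  which are built from Fin)

record Graph (V : Set) : Set where
  field
    adj    : V → V → Bool
    sym    : ∀ u v → adj u v ≡ adj v u
    irrefl : ∀ v → adj v v ≡ false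
open Graph public

K₃ : Graph (Fin 3)
K₃ = record { adj = _=/=_ ; sym = s ; irrefl = r }
  where
  open import Relation.Binary.PropositionalEquality using (refl)
  s : ∀ u v → (u =/= v) ≡ (v =/= u)
  s Fin.zero Fin.zero = refl
  s Fin.zero (Fin.suc Fin.zero) = refl
  s Fin.zero (Fin.suc (Fin.suc Fin.zero)) = refl
  s (Fin.suc Fin.zero) Fin.zero = refl
  s (Fin.suc Fin.zero) (Fin.suc Fin.zero) = refl
  s (Fin.suc Fin.zero) (Fin.suc (Fin.suc Fin.zero)) = refl
  s (Fin.suc (Fin.suc Fin.zero)) Fin.zero = refl
  s (Fin.suc (Fin.suc Fin.zero)) (Fin.suc Fin.zero) = refl
  s (Fin.suc (Fin.suc Fin.zero)) (Fin.suc (Fin.suc Fin.zero)) = refl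
  r : ∀ v → (v =/= v) ≡ false
  r Fin.zero = refl
  r (Fin.suc Fin.zero) = refl
  r (Fin.suc (Fin.suc Fin.zero)) = refl

tensorAdj : {A B : Set} → Graph A → Graph B → A × B → A × B → Bool
tensorAdj F G (f , g) (f' , g') = adj F f f' ∧ adj G g g'

PAdj : {m : ℕ} → Graph (Fin m) → Fin 3 × Fin m → Fin 3 × Fin m → Bool
PAdj G = tensorAdj K₃ G

PVerts : (m : ℕ) → List (Fin 3 × Fin m)
PVerts m = cartesianProduct (allFin 3) (allFin m)

degP : {m : ℕ} → Graph (Fin m) → Fin 3 × Fin m → ℕ
degP {m} G w = count (PVerts m) (PAdj G w)

IsNear : {W : Set} → (W → W → Bool) → ℚ → {m : ℕ} → Graph (Fin m) → Set
IsNear {W} H ε {m} G =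
  Σ (Fin 3 × Fin m → Fin 3 × Fin m → Bool) λ E' →
      (∀ a b → E' a b ≡ E' b a)
    × (∀ a b → E' a b ≡ true → PAdj G a b ≡ true)
    × (∀ w → ℕ→ℚ (count (PVerts m) (E' w)) ≤ ε * ℕ→ℚ (degP G w))
    × Σ (W ↔ (Fin 3 × Fin m)) λ f →
        ∀ x y → H x y ≡ (PAdj G (Inverse.to f x) (Inverse.to f y)
                          ∧ not (E' (Inverse.to f x) (Inverse.to f y)))

-- V = Fin n; E≠ and E= are sets of 2-element subsets of V, given as
-- symmetric irreflexive Boolean relations.
record Instance : Set where
  field
    n        : ℕ
    neq      : Fin n → Fin n → Bool
    eqc      : Fin n → Fin n → Bool
    neq-sym  : ∀ u v → neq u v ≡ neq v u
    eqc-sym  : ∀ u v → eqc u v ≡ eqc v u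
    neq-irr  : ∀ v → neq v v ≡ false
    eqc-irr  : ∀ v → eqc v v ≡ false
open Instance public

Satisfies : (I : Instance) → (Fin (n I) → Fin 3) → Set
Satisfies I φ =
    (∀ u v → neq I u v ≡ true → φ u ≢ φ v)
  × (∀ u v → eqc I u v ≡ true → φ u ≡ φ v)

Satisfiable : Instance → Set
Satisfiable I = ∃[ φ ] Satisfies I φ

#neq : (I : Instance) → Fin (n I) → ℕ
#neq I v = count (allFin (n I)) (neq I v)

#eqc : (I : Instance) → Fin (n I) → ℕ
#eqc I v = count (allFin (n I)) (eqc I v)

LooseVertex : ℚ → (I : Instance) → Fin (n I) → Set
LooseVertex δ I v = ℕ→ℚ (#neq I v) ≤ δ * ℕ→ℚ (#neq I v + #eqc I v)

Loose : ℚ → Instance → Set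
Loose δ I = ∀ v → LooseVertex δ I v

Cube : Set
Cube = Fin 3 × Fin 3 × Fin 3

allDiff : Cube → Cube → Bool
allDiff (x₁ , x₂ , x₃) (y₁ , y₂ , y₃) = (x₁ =/= y₁) ∧ (x₂ =/= y₂) ∧ (x₃ =/= y₃)

crossDiff : Cube → Cube → Bool
crossDiff (x₁ , x₂ , x₃) (y₁ , y₂ , y₃) =
  (x₁ =/= y₂) ∧ (x₁ =/= y₃) ∧ (x₂ =/= y₁) ∧ (x₂ =/= y₃) ∧ (x₃ =/= y₁) ∧ (x₃ =/= y₂)

reductionAdj : (I : Instance) → Fin (n I) × Cube → Fin (n I) × Cube → Bool
reductionAdj I (u , x) (v , y) =
     ((u == v) ∧ allDiff x y)
  ∨  (eqc I u v ∧ allDiff x y)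
  ∨  (neq I u v ∧ crossDiff x y)

-- G has a cell (u, s) for every variable u and s ∈ [3]², encoded in Fin (|V| · 9). Cells (u, s)
-- and (v, t) are adjacent when u, v are equal or equality-constrained and s, t differ in both
-- coordinates, and always when u, v are coloring-constrained. A satisfying assignment φ
-- identifies the vertex (u, x) of H with the vertex (x_{φ u}, (u, x without coordinate φ u)) of
-- K₃ × G. This embeds H into K₃ × G: across a coloring constraint φ u ≠ φ v, so the cross
-- condition yields x_{φ u} ≠ y_{φ v}; across an equality φ u = φ v, and "all coordinates differ"
-- splits into the two tensor factors, so there the two graphs agree. Hence every missing edge lies
-- over a coloring constraint: a vertex misses at most 2·9 edges per coloring constraint, while it
-- has at least 2·4 neighbours per equality constraint and 2·9 per coloring constraint. Looseness
-- gives #≠ ≤ cε(#≠ + #=), so at most 18cε(#≠ + #=) ≤ 6ε(#≠ + #=) ≤ ε(18 #≠ + 8 #=) edges are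
-- missing, using c < 1/3.

module Submission where

open import Defs
open import Data.Nat using (ℕ)
open import Data.Fin using (Fin)
open import Data.Integer using (+_)
open import Data.Rational using (ℚ; 0ℚ; _/_; _*_; _<_)
open import Data.Product using (∃; ∃-syntax)

open import Data.Bool using (Bool; true; false; _∧_; _∨_; not; if_then_else_)
open import Data.Bool.Properties
  using (∧-commutativeMonoid; ∧-conicalˡ; ∧-conicalʳ; ∧-identityʳ; ∧-zeroʳ; ∧-inverseʳ;
         ∧-distribʳ-∨; ∨-assoc; ∨-identityʳ; ∨-zeroʳ)
open import Algebra.Solver.CommutativeMonoid ∧-commutativeMonoid using (solve; _⊕_; _⊜_)
open import Data.Empty using (⊥-elim)
open import Data.Fin using (zero; suc; _↑ˡ_; _↑ʳ_; remQuot)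
open import Data.Fin.Patterns using (0F; 1F; 2F)
open import Data.Fin.Properties using (_≟_; splitAt-↑ˡ; splitAt-↑ʳ; *↔×)
open import Data.Integer using (+≤+) renaming (_≤_ to _≤ℤ_)
import Data.Integer.Properties as ℤ
open import Data.List using (List; []; _∷_; _++_; map; length; tabulate; allFin; cartesianProduct)
open import Data.List.Properties using (map-tabulate)
open import Data.Nat using (zero; suc; _+_; z≤n; s≤s)
import Data.Nat as ℕ
import Data.Nat.Properties as ℕ
open import Data.Nat.Coprimality using (1-coprimeTo) renaming (sym to coprime-sym)
open import Data.Nat.Tactic.RingSolver using (solve-∀)
open import Data.Product using (_×_; _,_; proj₁; proj₂; map₁; map₂)
open import Data.Product.Function.NonDependent.Propositional using (_×-↔_)
open import Data.Rational using (mkℚ; _≤_; *≤*; NonNegative; positive)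
open import Data.Rational.Properties
  using (normalize-coprime; *-assoc; *-comm; *-monoˡ-≤-nonNeg; *-monoʳ-≤-nonNeg; <⇒≤; pos⇒nonNeg;
         nonNeg*nonNeg⇒nonNeg; module ≤-Reasoning)
open import Function using (_∘_; id)
open import Function.Bundles using (_↔_; Inverse; mk↔ₛ′)
open import Function.Properties.Inverse using (↔-refl; ↔-trans)
open import Relation.Binary.PropositionalEquality
  using (_≡_; _≢_; refl; cong; cong₂; trans; subst; subst₂; module ≡-Reasoning)
import Relation.Binary.PropositionalEquality as ≡
open import Relation.Nullary using (yes; no)

module _ {A : Set} where

  count-++ : ∀ (xs ys : List A) p → count (xs ++ ys) p ≡ count xs p + count ys p
  count-++ []       ys p = refl
  count-++ (x ∷ xs) ys p with p x
  ... | true  = cong suc (count-++ xs ys p)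
  ... | false = count-++ xs ys p

  count-cong : ∀ (xs : List A) {p q} → (∀ x → p x ≡ q x) → count xs p ≡ count xs q
  count-cong []       p≗q = refl
  count-cong (x ∷ xs) {p} {q} p≗q rewrite p≗q x with q x
  ... | true  = cong suc (count-cong xs p≗q)
  ... | false = count-cong xs p≗q

  count-mono : ∀ (xs : List A) {p q} → (∀ x → p x ≡ true → q x ≡ true) → count xs p ℕ.≤ count xs q
  count-mono []       p⇒q = z≤n
  count-mono (x ∷ xs) {p} {q} p⇒q with p x in px | q x in qx
  ... | true  | true  = s≤s (count-mono xs p⇒q)
  ... | true  | false with () ← trans (≡.sym qx) (p⇒q x px)
  ... | false | true  = ℕ.m≤n⇒m≤1+n (count-mono xs p⇒q)
  ... | false | false = count-mono xs p⇒q

  count-∨ : ∀ (xs : List A) {p q} → (∀ x → p x ∧ q x ≡ false) →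
            count xs (λ x → p x ∨ q x) ≡ count xs p + count xs q
  count-∨ []       disj = refl
  count-∨ (x ∷ xs) {p} {q} disj with p x in px | q x in qx
  ... | true  | true  with () ← trans (≡.sym (cong₂ _∧_ px qx)) (disj x)
  ... | true  | false = cong suc (count-∨ xs disj)
  ... | false | true  = trans (cong suc (count-∨ xs disj)) (≡.sym (ℕ.+-suc _ _))
  ... | false | false = count-∨ xs disj

  count-const-false : ∀ (xs : List A) → count xs (λ _ → false) ≡ 0
  count-const-false []       = refl
  count-const-false (x ∷ xs) = count-const-false xs

  count-const-true : ∀ (xs : List A) → count xs (λ _ → true) ≡ length xs
  count-const-true []       = refl
  count-const-true (x ∷ xs) = cong suc (count-const-true xs)

  count-map : ∀ {B : Set} (f : B → A) xs p → count (map f xs) p ≡ count xs (p ∘ f)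
  count-map f []       p = refl
  count-map f (x ∷ xs) p with p (f x)
  ... | true  = cong suc (count-map f xs p)
  ... | false = count-map f xs p

count-× : ∀ {A B : Set} (xs : List A) (ys : List B) p q →
          count (cartesianProduct xs ys) (λ z → p (proj₁ z) ∧ q (proj₂ z))
          ≡ count xs p ℕ.* count ys q
count-× []       ys p q = refl
count-× (x ∷ xs) ys p q = begin
  count (map (x ,_) ys ++ cartesianProduct xs ys) r
    ≡⟨ count-++ (map (x ,_) ys) _ r ⟩
  count (map (x ,_) ys) r + count (cartesianProduct xs ys) r
    ≡⟨ cong₂ _+_ (count-map (x ,_) ys r) (count-× xs ys p q) ⟩
  count ys (λ y → p x ∧ q y) + count xs p ℕ.* count ys q
    ≡⟨ row (p x) ⟩
  count (x ∷ xs) p ℕ.* count ys q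
    ∎
  where
  open ≡-Reasoning
  r = λ z → p (proj₁ z) ∧ q (proj₂ z)
  row : ∀ b → count ys (λ y → b ∧ q y) + count xs p ℕ.* count ys q
            ≡ (if b then suc (count xs p) else count xs p) ℕ.* count ys q
  row true  = refl
  row false = cong (_+ count xs p ℕ.* count ys q) (count-const-false ys)

count-×ˡ : ∀ {A B : Set} (xs : List A) (ys : List B) p →
           count (cartesianProduct xs ys) (p ∘ proj₁) ≡ count xs p ℕ.* length ys
count-×ˡ xs ys p = begin
  count (cartesianProduct xs ys) (p ∘ proj₁)
    ≡⟨ count-cong (cartesianProduct xs ys) (λ z → ≡.sym (∧-identityʳ (p (proj₁ z)))) ⟩
  count (cartesianProduct xs ys) (λ z → p (proj₁ z) ∧ true)
    ≡⟨ count-× xs ys p (λ _ → true) ⟩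
  count xs p ℕ.* count ys (λ _ → true)
    ≡⟨ cong (count xs p ℕ.*_) (count-const-true ys) ⟩
  count xs p ℕ.* length ys
    ∎
  where open ≡-Reasoning

count-tabulate : ∀ {A : Set} {n} (f : Fin n → A) p → count (tabulate f) p ≡ count (allFin n) (p ∘ f)
count-tabulate f p =
  trans (cong (λ xs → count xs p) (≡.sym (map-tabulate id f))) (count-map f (allFin _) p)

count-allFin-+ : ∀ a {b} p →
  count (allFin (a + b)) p ≡ count (allFin a) (p ∘ (_↑ˡ b)) + count (allFin b) (p ∘ (a ↑ʳ_))
count-allFin-+ a {b} p =
  trans (split a id) (cong₂ _+_ (count-tabulate (_↑ˡ b) p) (count-tabulate (a ↑ʳ_) p))
  where
  split : ∀ a {A : Set} (f : Fin (a + b) → A) {p} →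
          count (tabulate f) p ≡ count (tabulate (f ∘ (_↑ˡ b))) p + count (tabulate (f ∘ (a ↑ʳ_))) p
  split zero    f = refl
  split (suc a) f {p} with p (f zero)
  ... | true  = cong suc (split a (f ∘ suc))
  ... | false = split a (f ∘ suc)

remQuot-↑ˡ : ∀ {m} n (i : Fin n) → remQuot {suc m} n (i ↑ˡ m ℕ.* n) ≡ (zero , i)
remQuot-↑ˡ {m} n i rewrite splitAt-↑ˡ n i (m ℕ.* n) = refl

remQuot-↑ʳ : ∀ {m} n (j : Fin (m ℕ.* n)) → remQuot {suc m} n (n ↑ʳ j) ≡ map₁ suc (remQuot {m} n j)
remQuot-↑ʳ {m} n j rewrite splitAt-↑ʳ n (m ℕ.* n) j = refl

count-allFin-* : ∀ m {n} q →
  count (allFin (m ℕ.* n)) (q ∘ remQuot n) ≡ count (cartesianProduct (allFin m) (allFin n)) q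
count-allFin-* m {n} q = go m id
  where
  go : ∀ m {A : Set} (g : Fin m → A) {q : A × Fin n → Bool} →
       count (allFin (m ℕ.* n)) (q ∘ map₁ g ∘ remQuot n)
       ≡ count (cartesianProduct (tabulate g) (allFin n)) q
  go zero    g = refl
  go (suc m) g {q} = begin
    count (allFin (n + m ℕ.* n)) (q ∘ map₁ g ∘ remQuot n)
      ≡⟨ count-allFin-+ n _ ⟩
    count (allFin n) (q ∘ map₁ g ∘ remQuot n ∘ (_↑ˡ m ℕ.* n))
      + count (allFin (m ℕ.* n)) (q ∘ map₁ g ∘ remQuot n ∘ (n ↑ʳ_))
      ≡⟨ cong₂ _+_ (count-cong (allFin n) (cong (q ∘ map₁ g) ∘ remQuot-↑ˡ n))
                   (count-cong (allFin (m ℕ.* n)) (cong (q ∘ map₁ g) ∘ remQuot-↑ʳ n)) ⟩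
    count (allFin n) (q ∘ (g zero ,_)) + count (allFin (m ℕ.* n)) (q ∘ map₁ (g ∘ suc) ∘ remQuot n)
      ≡⟨ cong₂ _+_ (≡.sym (count-map (g zero ,_) (allFin n) q)) (go m (g ∘ suc)) ⟩
    count (map (g zero ,_) (allFin n)) q
      + count (cartesianProduct (tabulate (g ∘ suc)) (allFin n)) q
      ≡⟨ ≡.sym (count-++ (map (g zero ,_) (allFin n)) _ q) ⟩
    count (cartesianProduct (tabulate g) (allFin n)) q ∎
    where open ≡-Reasoning

ℕ→ℚ-≡-mkℚ : ∀ k → ℕ→ℚ k ≡ mkℚ (+ k) 0 (coprime-sym (1-coprimeTo k))
ℕ→ℚ-≡-mkℚ k = normalize-coprime (coprime-sym (1-coprimeTo k))

ℕ→ℚ-mono-≤ : ∀ {a b} → a ℕ.≤ b → ℕ→ℚ a ≤ ℕ→ℚ b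
ℕ→ℚ-mono-≤ {a} {b} a≤b rewrite ℕ→ℚ-≡-mkℚ a | ℕ→ℚ-≡-mkℚ b =
  *≤* (subst₂ _≤ℤ_ (≡.sym (ℤ.*-identityʳ (+ a))) (≡.sym (ℤ.*-identityʳ (+ b))) (+≤+ a≤b))

ℕ→ℚ-* : ∀ a b → ℕ→ℚ (a ℕ.* b) ≡ ℕ→ℚ a * ℕ→ℚ b
ℕ→ℚ-* a b rewrite ℕ→ℚ-≡-mkℚ a | ℕ→ℚ-≡-mkℚ b = cong (_/ 1) (ℤ.pos-* a b)

ℕ→ℚ-nonNeg : ∀ k → NonNegative (ℕ→ℚ k)
ℕ→ℚ-nonNeg k rewrite ℕ→ℚ-≡-mkℚ k = _

lost≤ε*deg : ∀ {ε c} → 0ℚ < ε → c < + 1 / 3 → ∀ a b {lost deg} →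
  ℕ→ℚ a ≤ (c * ε) * ℕ→ℚ (a + b) → lost ℕ.≤ 2 ℕ.* (a ℕ.* 9) → 2 ℕ.* (b ℕ.* 4 + a ℕ.* 9) ℕ.≤ deg →
  ℕ→ℚ lost ≤ ε * ℕ→ℚ deg
lost≤ε*deg {ε} {c} 0<ε c<⅓ a b {lost} {deg} a≤cεq lost≤ deg≥ = begin
  ℕ→ℚ lost                ≤⟨ ℕ→ℚ-mono-≤ (ℕ.≤-trans lost≤ (ℕ.≤-reflexive (2[9a]≡18a a))) ⟩
  ℕ→ℚ (18 ℕ.* a)          ≡⟨ ℕ→ℚ-* 18 a ⟩
  ℕ→ℚ 18 * ℕ→ℚ a          ≤⟨ *-monoˡ-≤-nonNeg (ℕ→ℚ 18) {{ℕ→ℚ-nonNeg 18}} a≤cεq ⟩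
  ℕ→ℚ 18 * ((c * ε) * q)  ≡⟨ cong (ℕ→ℚ 18 *_) (*-assoc c ε q) ⟩
  ℕ→ℚ 18 * (c * (ε * q))  ≡⟨ *-assoc (ℕ→ℚ 18) c (ε * q) ⟨
  (ℕ→ℚ 18 * c) * (ε * q)  ≤⟨ *-monoʳ-≤-nonNeg (ε * q) {{εq-nonNeg}} 18c≤6 ⟩
  ℕ→ℚ 6 * (ε * q)         ≡⟨ *-assoc (ℕ→ℚ 6) ε q ⟨
  (ℕ→ℚ 6 * ε) * q         ≡⟨ cong (_* q) (*-comm (ℕ→ℚ 6) ε) ⟩
  (ε * ℕ→ℚ 6) * q         ≡⟨ *-assoc ε (ℕ→ℚ 6) q ⟩
  ε * (ℕ→ℚ 6 * q)         ≡⟨ cong (ε *_) (ℕ→ℚ-* 6 (a + b)) ⟨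
  ε * ℕ→ℚ (6 ℕ.* (a + b)) ≤⟨ *-monoˡ-≤-nonNeg ε {{ε-nonNeg}} (ℕ→ℚ-mono-≤ (ℕ.≤-trans 6[a+b]≤ deg≥)) ⟩
  ε * ℕ→ℚ deg             ∎
  where
  open ≤-Reasoning
  q = ℕ→ℚ (a + b)
  ε-nonNeg : NonNegative ε
  ε-nonNeg = pos⇒nonNeg ε {{positive 0<ε}}
  εq-nonNeg : NonNegative (ε * q)
  εq-nonNeg = nonNeg*nonNeg⇒nonNeg ε {{ε-nonNeg}} q {{ℕ→ℚ-nonNeg (a + b)}}
  18c≤6 : ℕ→ℚ 18 * c ≤ ℕ→ℚ 6
  18c≤6 = *-monoˡ-≤-nonNeg (ℕ→ℚ 18) {{ℕ→ℚ-nonNeg 18}} (<⇒≤ c<⅓)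
  2[9a]≡18a : ∀ a → 2 ℕ.* (a ℕ.* 9) ≡ 18 ℕ.* a
  2[9a]≡18a = solve-∀
  6[a+b]+rest≡ : ∀ a b → 6 ℕ.* (a + b) + (12 ℕ.* a + 2 ℕ.* b) ≡ 2 ℕ.* (b ℕ.* 4 + a ℕ.* 9)
  6[a+b]+rest≡ = solve-∀
  6[a+b]≤ : 6 ℕ.* (a + b) ℕ.≤ 2 ℕ.* (b ℕ.* 4 + a ℕ.* 9)
  6[a+b]≤ = ℕ.≤-trans (ℕ.m≤m+n _ _) (ℕ.≤-reflexive (6[a+b]+rest≡ a b))

tensorAdj-sym : ∀ {A B : Set} (F : Graph A) (G : Graph B) a b →
  tensorAdj F G a b ≡ tensorAdj F G b a
tensorAdj-sym F G (f , g) (f' , g') = cong₂ _∧_ (sym F f f') (sym G g g')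

module _ {W : Set} {m : ℕ} (G : Graph (Fin m)) (H : W → W → Bool) (ι : W ↔ (Fin 3 × Fin m)) where
  open Inverse ι using (to; from; strictlyInverseʳ)

  missingEdges : Fin 3 × Fin m → Fin 3 × Fin m → Bool
  missingEdges a b = PAdj G a b ∧ not (H (from a) (from b))

  isNear-subgraph : ∀ {ε} → (∀ x y → H x y ≡ H y x) →
    (∀ a b → H (from a) (from b) ≡ true → PAdj G a b ≡ true) →
    (∀ w → ℕ→ℚ (count (PVerts m) (missingEdges w)) ≤ ε * ℕ→ℚ (degP G w)) →
    IsNear H ε G
  isNear-subgraph H-sym H⊆P few-missing =
    missingEdges , missing-sym , (λ a b → ∧-conicalˡ _ _) , few-missing , ι , H≡P-missing
    where
    missing-sym : ∀ a b → missingEdges a b ≡ missingEdges b a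
    missing-sym a b = cong₂ (λ p h → p ∧ not h) (tensorAdj-sym K₃ G a b) (H-sym (from a) (from b))

    complement-of-complement : ∀ h p → (h ≡ true → p ≡ true) → h ≡ p ∧ not (p ∧ not h)
    complement-of-complement true  true  _   = refl
    complement-of-complement true  false h⇒p with () ← h⇒p refl
    complement-of-complement false true  _   = refl
    complement-of-complement false false _   = refl

    H≡P-missing : ∀ x y → H x y ≡ (PAdj G (to x) (to y) ∧ not (missingEdges (to x) (to y)))
    H≡P-missing x y rewrite strictlyInverseʳ x | strictlyInverseʳ y =
      complement-of-complement (H x y) (PAdj G (to x) (to y)) (H⊆P (to x) (to y) ∘ on-to)
      where
      on-to : H x y ≡ true → H (from (to x)) (from (to y)) ≡ true
      on-to = subst₂ (λ x′ y′ → H x′ y′ ≡ true)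
                     (≡.sym (strictlyInverseʳ x)) (≡.sym (strictlyInverseʳ y))

Square : Set
Square = Fin 3 × Fin 3

squareAdj : Square → Square → Bool
squareAdj = tensorAdj K₃ K₃

coord : Fin 3 → Cube → Fin 3
coord 0F (x , _ , _) = x
coord 1F (_ , x , _) = x
coord 2F (_ , _ , x) = x

remove : Fin 3 → Cube → Square
remove 0F (_ , y , z) = y , z
remove 1F (x , _ , z) = x , z
remove 2F (x , y , _) = x , y

insertAt : Fin 3 → Fin 3 → Square → Cube
insertAt 0F k (y , z) = k , y , z
insertAt 1F k (x , z) = x , k , z
insertAt 2F k (x , y) = x , y , k

coord-insertAt : ∀ a k s → coord a (insertAt a k s) ≡ k
coord-insertAt 0F k s = refl
coord-insertAt 1F k s = refl
coord-insertAt 2F k s = refl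

remove-insertAt : ∀ a k s → remove a (insertAt a k s) ≡ s
remove-insertAt 0F k s = refl
remove-insertAt 1F k s = refl
remove-insertAt 2F k s = refl

insertAt-coord-remove : ∀ a X → insertAt a (coord a X) (remove a X) ≡ X
insertAt-coord-remove 0F X = refl
insertAt-coord-remove 1F X = refl
insertAt-coord-remove 2F X = refl

=/=-sym : ∀ (i j : Fin 3) → (i =/= j) ≡ (j =/= i)
=/=-sym = sym K₃

allDiff-sym : ∀ X Y → allDiff X Y ≡ allDiff Y X
allDiff-sym (x₁ , x₂ , x₃) (y₁ , y₂ , y₃) =
  cong₂ _∧_ (=/=-sym x₁ y₁) (cong₂ _∧_ (=/=-sym x₂ y₂) (=/=-sym x₃ y₃))

crossDiff-sym : ∀ X Y → crossDiff X Y ≡ crossDiff Y X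
crossDiff-sym (x₁ , x₂ , x₃) (y₁ , y₂ , y₃)
  rewrite =/=-sym y₁ x₂ | =/=-sym y₁ x₃ | =/=-sym y₂ x₁
        | =/=-sym y₂ x₃ | =/=-sym y₃ x₁ | =/=-sym y₃ x₂ =
  solve 6 (λ a b c d e f → a ⊕ b ⊕ c ⊕ d ⊕ e ⊕ f ⊜ c ⊕ e ⊕ a ⊕ f ⊕ b ⊕ d) refl
    (x₁ =/= y₂) (x₁ =/= y₃) (x₂ =/= y₁) (x₂ =/= y₃) (x₃ =/= y₁) (x₃ =/= y₂)

allDiff-insertAt : ∀ a k s l t →
  allDiff (insertAt a k s) (insertAt a l t) ≡ (k =/= l) ∧ squareAdj s t
allDiff-insertAt 0F k s l t = refl
allDiff-insertAt 1F k (x , z) l (x' , z') =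
  solve 3 (λ a b c → b ⊕ a ⊕ c ⊜ a ⊕ b ⊕ c) refl (k =/= l) (x =/= x') (z =/= z')
allDiff-insertAt 2F k (x , y) l (x' , y') =
  solve 3 (λ a b c → b ⊕ c ⊕ a ⊜ a ⊕ b ⊕ c) refl (k =/= l) (x =/= x') (y =/= y')

private
  ∧⇒ˡ : ∀ {x y} → x ∧ y ≡ true → x ≡ true
  ∧⇒ˡ = ∧-conicalˡ _ _

  ∧⇒ʳ : ∀ x {y} → x ∧ y ≡ true → y ≡ true
  ∧⇒ʳ x = ∧-conicalʳ x _

crossDiff-insertAt : ∀ {a b} k s l t → a ≢ b →
  crossDiff (insertAt a k s) (insertAt b l t) ≡ true → (k =/= l) ≡ true
crossDiff-insertAt {0F} {0F} k s l t a≢b h = ⊥-elim (a≢b refl)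
crossDiff-insertAt {1F} {1F} k s l t a≢b h = ⊥-elim (a≢b refl)
crossDiff-insertAt {2F} {2F} k s l t a≢b h = ⊥-elim (a≢b refl)
crossDiff-insertAt {0F} {1F} k (x , y) l (x' , y') _ h = ∧⇒ˡ h
crossDiff-insertAt {0F} {2F} k (x , y) l (x' , y') _ h = ∧⇒ˡ (∧⇒ʳ (k =/= y') h)
crossDiff-insertAt {1F} {0F} k (x , y) l (x' , y') _ h = ∧⇒ˡ (∧⇒ʳ (x =/= y') (∧⇒ʳ (x =/= x') h))
crossDiff-insertAt {1F} {2F} k (x , y) l (x' , y') _ h =
  ∧⇒ˡ (∧⇒ʳ (k =/= x') (∧⇒ʳ (x =/= l) (∧⇒ʳ (x =/= y') h)))
crossDiff-insertAt {2F} {0F} k (x , y) l (x' , y') _ h =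
  ∧⇒ˡ (∧⇒ʳ (y =/= y') (∧⇒ʳ (y =/= l) (∧⇒ʳ (x =/= y') (∧⇒ʳ (x =/= x') h))))
crossDiff-insertAt {2F} {1F} k (x , y) l (x' , y') _ h =
  ∧⇒ʳ (k =/= x') (∧⇒ʳ (y =/= y') (∧⇒ʳ (y =/= x') (∧⇒ʳ (x =/= y') (∧⇒ʳ (x =/= l) h))))

-- For variables u and v: eq says that they must get the same colour (u = v or an equality
-- constraint), ne that they are coloring-constrained, and a, b are their colours.
Consistent : Fin 3 → Fin 3 → Bool → Bool → Set
Consistent a b eq ne = (eq ≡ true → a ≡ b) × (ne ≡ true → a ≢ b)

cubeAdj : Bool → Bool → Cube → Cube → Bool
cubeAdj eq ne X Y = (eq ∧ allDiff X Y) ∨ (ne ∧ crossDiff X Y)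

gadgetAdj : Bool → Bool → Square → Square → Bool
gadgetAdj eq ne s t = (eq ∧ squareAdj s t) ∨ ne

cubeAdj-sym : ∀ eq ne X Y → cubeAdj eq ne X Y ≡ cubeAdj eq ne Y X
cubeAdj-sym eq ne X Y = cong₂ (λ p q → (eq ∧ p) ∨ (ne ∧ q)) (allDiff-sym X Y) (crossDiff-sym X Y)

gadgetAdj-sym : ∀ eq ne s t → gadgetAdj eq ne s t ≡ gadgetAdj eq ne t s
gadgetAdj-sym eq ne s t = cong (λ p → (eq ∧ p) ∨ ne) (tensorAdj-sym K₃ K₃ s t)

cubeAdj⇒tensorAdj : ∀ {a b eq ne} k s l t → Consistent a b eq ne →
  cubeAdj eq ne (insertAt a k s) (insertAt b l t) ≡ true → (k =/= l) ∧ gadgetAdj eq ne s t ≡ true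
cubeAdj⇒tensorAdj {eq = true}  {true}  k s l t (a≡b , a≢b) h = ⊥-elim (a≢b refl (a≡b refl))
cubeAdj⇒tensorAdj {eq = false} {true}  k s l t (_ , a≢b) h
  rewrite ∧-identityʳ (k =/= l) = crossDiff-insertAt k s l t (a≢b refl) h
cubeAdj⇒tensorAdj {a} {eq = true} {false} k s l t (a≡b , _) h
  with refl ← a≡b refl
  rewrite ∨-identityʳ (squareAdj s t) | ∨-identityʳ (allDiff (insertAt a k s) (insertAt a l t)) =
  trans (≡.sym (allDiff-insertAt a k s l t)) h
cubeAdj⇒tensorAdj {eq = false} {false} k s l t _ ()

tensorAdj∖cubeAdj⇒ne : ∀ {a b eq ne} k s l t → Consistent a b eq ne →
  ((k =/= l) ∧ gadgetAdj eq ne s t) ∧ not (cubeAdj eq ne (insertAt a k s) (insertAt b l t)) ≡ true →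
  (k =/= l) ∧ ne ≡ true
tensorAdj∖cubeAdj⇒ne {ne = true} k s l t _ h
  rewrite ∧-identityʳ (k =/= l) = ∧⇒ˡ (∧⇒ˡ h)
tensorAdj∖cubeAdj⇒ne {eq = false} {false} k s l t _ h
  rewrite ∧-zeroʳ (k =/= l) with () ← h
tensorAdj∖cubeAdj⇒ne {a} {eq = true} {false} k s l t (a≡b , _) h
  with refl ← a≡b refl
  rewrite ∨-identityʳ (squareAdj s t) | ∨-identityʳ (allDiff (insertAt a k s) (insertAt a l t))
        | allDiff-insertAt a k s l t | ∧-inverseʳ ((k =/= l) ∧ squareAdj s t)
  with () ← h

gadgetAdj-monoˡ : ∀ {eq eq′} ne s t → (eq ≡ true → eq′ ≡ true) →
  gadgetAdj eq ne s t ≡ true → gadgetAdj eq′ ne s t ≡ true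
gadgetAdj-monoˡ {true}  {true}  ne s t _   h = h
gadgetAdj-monoˡ {true}  {false} ne s t eq⇒eq′ h with () ← eq⇒eq′ refl
gadgetAdj-monoˡ {false} {eq′}   ne s t _   h =
  subst (λ b → (eq′ ∧ squareAdj s t) ∨ b ≡ true) (≡.sym h) (∨-zeroʳ _)

==-sym : ∀ {m} (u v : Fin m) → (u == v) ≡ (v == u)
==-sym u v with u ≟ v | v ≟ u
... | yes _   | yes _   = refl
... | no  _   | no  _   = refl
... | yes u≡v | no  v≢u = ⊥-elim (v≢u (≡.sym u≡v))
... | no  u≢v | yes v≡u = ⊥-elim (u≢v (≡.sym v≡u))

K₃-degree : ∀ k → count (allFin 3) (adj K₃ k) ≡ 2
K₃-degree 0F = refl
K₃-degree 1F = refl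
K₃-degree 2F = refl

count-PVerts : ∀ {m} k q →
  count (PVerts m) (λ z → adj K₃ k (proj₁ z) ∧ q (proj₂ z)) ≡ 2 ℕ.* count (allFin m) q
count-PVerts {m} k q =
  trans (count-× (allFin 3) (allFin m) (adj K₃ k) q) (cong (ℕ._* count (allFin m) q) (K₃-degree k))

squareAdj-degree : ∀ s → count (allFin 9) (squareAdj s ∘ remQuot 3) ≡ 4
squareAdj-degree (x , y) = begin
  count (allFin 9) (squareAdj (x , y) ∘ remQuot 3)
    ≡⟨ count-allFin-* 3 (squareAdj (x , y)) ⟩
  count (cartesianProduct (allFin 3) (allFin 3)) (squareAdj (x , y))
    ≡⟨ count-× (allFin 3) (allFin 3) (adj K₃ x) (adj K₃ y) ⟩
  count (allFin 3) (adj K₃ x) ℕ.* count (allFin 3) (adj K₃ y)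
    ≡⟨ cong₂ ℕ._*_ (K₃-degree x) (K₃-degree y) ⟩
  4 ∎
  where open ≡-Reasoning

module Reduction (I : Instance) where

  equated : Fin (n I) → Fin (n I) → Bool
  equated u v = (u == v) ∨ eqc I u v

  reductionAdj≡cubeAdj : ∀ u v X Y →
    reductionAdj I (u , X) (v , Y) ≡ cubeAdj (equated u v) (neq I u v) X Y
  reductionAdj≡cubeAdj u v X Y =
    trans (≡.sym (∨-assoc ((u == v) ∧ allDiff X Y) (eqc I u v ∧ allDiff X Y) coloring))
          (cong (_∨ coloring) (≡.sym (∧-distribʳ-∨ (allDiff X Y) (u == v) (eqc I u v))))
    where coloring = neq I u v ∧ crossDiff X Y

  equated-sym : ∀ u v → equated u v ≡ equated v u
  equated-sym u v = cong₂ _∨_ (==-sym u v) (eqc-sym I u v)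

  reductionAdj-sym : ∀ x y → reductionAdj I x y ≡ reductionAdj I y x
  reductionAdj-sym (u , X) (v , Y) = begin
    reductionAdj I (u , X) (v , Y)        ≡⟨ reductionAdj≡cubeAdj u v X Y ⟩
    cubeAdj (equated u v) (neq I u v) X Y
      ≡⟨ cong₂ (λ eq ne → cubeAdj eq ne X Y) (equated-sym u v) (neq-sym I u v) ⟩
    cubeAdj (equated v u) (neq I v u) X Y ≡⟨ cubeAdj-sym (equated v u) (neq I v u) X Y ⟩
    cubeAdj (equated v u) (neq I v u) Y X ≡⟨ reductionAdj≡cubeAdj v u Y X ⟨
    reductionAdj I (v , Y) (u , X)        ∎
    where open ≡-Reasoning

  Cell : Set
  Cell = Fin (n I) × Square

  cells : Fin (n I ℕ.* 9) ↔ Cell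
  cells = ↔-trans *↔× (↔-refl ×-↔ *↔×)

  open Inverse cells using () renaming (to to decode; from to encode)

  cellAdj : Cell → Cell → Bool
  cellAdj (u , s) (v , t) = gadgetAdj (equated u v) (neq I u v) s t

  cellAdj-sym : ∀ c d → cellAdj c d ≡ cellAdj d c
  cellAdj-sym (u , s) (v , t) =
    trans (cong₂ (λ eq ne → gadgetAdj eq ne s t) (equated-sym u v) (neq-sym I u v))
          (gadgetAdj-sym (equated v u) (neq I v u) s t)

  cellAdj-irrefl : ∀ c → cellAdj c c ≡ false
  cellAdj-irrefl (u , (x , y)) rewrite neq-irr I u | irrefl K₃ x =
    trans (∨-identityʳ (equated u u ∧ false)) (∧-zeroʳ (equated u u))

  cellGraph : Graph (Fin (n I ℕ.* 9))
  cellGraph = record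
    { adj    = λ i j → cellAdj (decode i) (decode j)
    ; sym    = λ i j → cellAdj-sym (decode i) (decode j)
    ; irrefl = λ i → cellAdj-irrefl (decode i)
    }

  cellIndices : List (Fin (n I) × Fin 9)
  cellIndices = cartesianProduct (allFin (n I)) (allFin 9)

  count-cells : ∀ q →
    count (allFin (n I ℕ.* 9)) (q ∘ decode) ≡ count cellIndices (q ∘ map₂ (remQuot 3))
  count-cells q = count-allFin-* (n I) (q ∘ map₂ (remQuot 3))

  module Coloring (φ : Fin (n I) → Fin 3) (sat : Satisfies I φ) where

    consistent : ∀ u v → Consistent (φ u) (φ v) (equated u v) (neq I u v)
    consistent u v = equated⇒same , proj₁ sat u v
      where
      equated⇒same : (u == v) ∨ eqc I u v ≡ true → φ u ≡ φ v
      equated⇒same h with u ≟ v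
      ... | yes u≡v = cong φ u≡v
      ... | no  _   = proj₂ sat u v h

    place : Fin 3 → Cell → Fin (n I) × Cube
    place k (u , s) = u , insertAt (φ u) k s

    placement : (Fin (n I) × Cube) ↔ (Fin 3 × Fin (n I ℕ.* 9))
    placement = mk↔ₛ′ to from to-from from-to
      where
      to : Fin (n I) × Cube → Fin 3 × Fin (n I ℕ.* 9)
      to (u , X) = coord (φ u) X , encode (u , remove (φ u) X)

      from : Fin 3 × Fin (n I ℕ.* 9) → Fin (n I) × Cube
      from (k , i) = place k (decode i)

      to-from : ∀ w → to (from w) ≡ w
      to-from (k , i) = cong₂ _,_ (coord-insertAt (φ u) k s)
        (trans (cong (λ r → encode (u , r)) (remove-insertAt (φ u) k s))
               (Inverse.strictlyInverseʳ cells i))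
        where
        u = proj₁ (decode i)
        s = proj₂ (decode i)

      from-to : ∀ x → from (to x) ≡ x
      from-to (u , X) =
        trans (cong (place (coord (φ u) X)) (Inverse.strictlyInverseˡ cells (u , remove (φ u) X)))
              (cong (u ,_) (insertAt-coord-remove (φ u) X))

    H⊆P : ∀ w z → reductionAdj I (Inverse.from placement w) (Inverse.from placement z) ≡ true →
          PAdj cellGraph w z ≡ true
    H⊆P (k , i) (l , j) = go k (decode i) l (decode j)
      where
      go : ∀ k c l d →
           reductionAdj I (place k c) (place l d) ≡ true → (k =/= l) ∧ cellAdj c d ≡ true
      go k (u , s) l (v , t) h = cubeAdj⇒tensorAdj k s l t (consistent u v)
        (trans (≡.sym (reductionAdj≡cubeAdj u v (insertAt (φ u) k s) (insertAt (φ v) l t))) h)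

    vertexOf : Fin 3 × Fin (n I ℕ.* 9) → Fin (n I)
    vertexOf (_ , i) = proj₁ (decode i)

    missing⇒coloring : ∀ w z → missingEdges cellGraph (reductionAdj I) placement w z ≡ true →
                       adj K₃ (proj₁ w) (proj₁ z) ∧ neq I (vertexOf w) (vertexOf z) ≡ true
    missing⇒coloring (k , i) (l , j) = go k (decode i) l (decode j)
      where
      go : ∀ k c l d →
           ((k =/= l) ∧ cellAdj c d) ∧ not (reductionAdj I (place k c) (place l d)) ≡ true →
           (k =/= l) ∧ neq I (proj₁ c) (proj₁ d) ≡ true
      go k (u , s) l (v , t) h = tensorAdj∖cubeAdj⇒ne k s l t (consistent u v)
        (subst (λ b → ((k =/= l) ∧ cellAdj (u , s) (v , t)) ∧ not b ≡ true)
               (reductionAdj≡cubeAdj u v (insertAt (φ u) k s) (insertAt (φ v) l t)) h)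

    eqc-neq-disjoint : ∀ u v b → (eqc I u v ∧ b) ∧ neq I u v ≡ false
    eqc-neq-disjoint u v b with eqc I u v in e | neq I u v in ne
    ... | false | _     = refl
    ... | true  | false = ∧-zeroʳ b
    ... | true  | true  = ⊥-elim (proj₁ sat u v ne (proj₂ sat u v e))

    missing-count : ∀ w →
      count (PVerts (n I ℕ.* 9)) (missingEdges cellGraph (reductionAdj I) placement w)
      ℕ.≤ 2 ℕ.* (#neq I (vertexOf w) ℕ.* 9)
    missing-count w@(k , i) = begin
      count (PVerts _) (missingEdges cellGraph (reductionAdj I) placement w)
        ≤⟨ count-mono (PVerts _) (missing⇒coloring w) ⟩
      count (PVerts _) (λ z → adj K₃ k (proj₁ z) ∧ neq I u (vertexOf z))
        ≡⟨ count-PVerts k (neq I u ∘ proj₁ ∘ decode) ⟩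
      2 ℕ.* count (allFin _) (neq I u ∘ proj₁ ∘ decode)
        ≡⟨ cong (2 ℕ.*_) (count-cells (neq I u ∘ proj₁)) ⟩
      2 ℕ.* count cellIndices (neq I u ∘ proj₁)
        ≡⟨ cong (2 ℕ.*_) (count-×ˡ (allFin (n I)) (allFin 9) (neq I u)) ⟩
      2 ℕ.* (#neq I u ℕ.* 9)
        ∎
      where
      open ℕ.≤-Reasoning
      u = vertexOf w

    degree-bound : ∀ w →
      2 ℕ.* (#eqc I (vertexOf w) ℕ.* 4 + #neq I (vertexOf w) ℕ.* 9) ℕ.≤ degP cellGraph w
    degree-bound (k , i) = begin
      2 ℕ.* (#eqc I u ℕ.* 4 + #neq I u ℕ.* 9)
        ≡⟨ cong (2 ℕ.*_) (cong₂ _+_ equated-part coloring-part) ⟨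
      2 ℕ.* (count cellIndices equatedNbr + count cellIndices coloringNbr)
        ≡⟨ cong (2 ℕ.*_) (count-∨ cellIndices (λ z → eqc-neq-disjoint u (proj₁ z) _)) ⟨
      2 ℕ.* count cellIndices (λ z → equatedNbr z ∨ coloringNbr z)
        ≤⟨ ℕ.*-monoʳ-≤ 2 (count-mono cellIndices λ z → gadgetAdj-monoˡ _ s _ (eqc⇒equated (proj₁ z))) ⟩
      2 ℕ.* count cellIndices (cellAdj (u , s) ∘ map₂ (remQuot 3))
        ≡⟨ cong (2 ℕ.*_) (count-cells (cellAdj (u , s))) ⟨
      2 ℕ.* count (allFin _) (cellAdj (u , s) ∘ decode)
        ≡⟨ count-PVerts k (cellAdj (u , s) ∘ decode) ⟨
      degP cellGraph (k , i)
        ∎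
      where
      open ℕ.≤-Reasoning
      u = proj₁ (decode i)
      s = proj₂ (decode i)
      equatedNbr coloringNbr : Fin (n I) × Fin 9 → Bool
      equatedNbr (v , r) = eqc I u v ∧ squareAdj s (remQuot 3 r)
      coloringNbr (v , r) = neq I u v
      eqc⇒equated : ∀ v → eqc I u v ≡ true → equated u v ≡ true
      eqc⇒equated v e = trans (cong ((u == v) ∨_) e) (∨-zeroʳ (u == v))
      equated-part : count cellIndices equatedNbr ≡ #eqc I u ℕ.* 4
      equated-part = trans (count-× (allFin (n I)) (allFin 9) (eqc I u) (squareAdj s ∘ remQuot 3))
                           (cong (#eqc I u ℕ.*_) (squareAdj-degree s))
      coloring-part : count cellIndices coloringNbr ≡ #neq I u ℕ.* 9
      coloring-part = count-×ˡ (allFin (n I)) (allFin 9) (neq I u)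

lemma4p3 : (ε cₗ : ℚ) → 0ℚ < ε → cₗ < + 1 / 3 →
    (I : Instance) → Satisfiable I → Loose (cₗ * ε) I →
    ∃[ m ] ∃ λ (G : Graph (Fin m)) → IsNear (reductionAdj I) ε G
lemma4p3 ε cₗ 0<ε cₗ<⅓ I (φ , sat) loose =
  n I ℕ.* 9 , cellGraph ,
  isNear-subgraph cellGraph (reductionAdj I) placement {ε} reductionAdj-sym H⊆P
    (λ w → lost≤ε*deg 0<ε cₗ<⅓ (#neq I (vertexOf w)) (#eqc I (vertexOf w))
             (loose (vertexOf w)) (missing-count w) (degree-bound w))
  where
  open Reduction I
  open Coloring φ sat
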